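{- For all integers $n\geqslant 3$ and $2\leqslant m \leqslant n+1$, $\kappa(FQ_{n};K_{1,m})\leqslant \left\lceil\frac{n+1}{2}\right\rceil$.
   Context: All graphs are finite, simple and undirected. The $n$-dimensional hypercube $Q_n$ has as vertices all $n$-bit binary strings $x=x_nx_{n-1}\ldots x_1$, with $x$ adjacent to $y$ iff they differ in exactly one position. The $n$-dimensional folded hypercube $FQ_n$ is obtained from $Q_n$ by adding the $2^{n-1}$ edges $x\overline{x}$, where $\overline{x}=\overline{x_n}\,\overline{x_{n-1}}\ldots\overline{x_1}$ and $\overline{x_i}=1-x_i$. $K_{1,m}$ denotes the star with $m$ leaves. For a set $F$ of subgraphs of a graph $G$, let $V(F)$ be the set of vertices contained in some member of $F$; $F$ is a subgraph cut of $G$ if $G-V(F)$ is disconnected or consists of a single vertex. For a connected graph $H$, an $H$-structure cut is a subgraph cut each of whose members is isomorphic to $H$; the $H$-structure connectivity $\kappa(G;H)$ is the minimum cardinality of an $H$-structure cut of $G$. -}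

module Defs where

open import Data.Nat using (ℕ; _≤_)
open import Data.Bool using (Bool; not)
open import Data.Fin using (Fin)
open import Data.Vec using (Vec; map; lookup; _[_]%=_)
open import Data.List using (List; length)
open import Data.List.Relation.Unary.Any using (Any)
open import Data.Product using (Σ; ∃; ∃-syntax; _×_; _,_)
open import Data.Sum using (_⊎_)
open import Relation.Nullary using (¬_)
open import Relation.Binary.PropositionalEquality using (_≡_)

Vertex : ℕ → Set
Vertex n = Vec Bool n

compl : ∀ {n} → Vertex n → Vertex n
compl = map not

FQAdj : (n : ℕ) → Vertex n → Vertex n → Set
FQAdj n x y = (∃[ i ] y ≡ (x [ i ]%= not)) ⊎ (y ≡ compl x)

record Star (n m : ℕ) : Set where
  field
    center   : Vertex n
    leaves   : Vec (Vertex n) m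
    distinct : ∀ (i j : Fin m) → lookup leaves i ≡ lookup leaves j → i ≡ j
    adj      : ∀ (i : Fin m) → FQAdj n center (lookup leaves i)
open Star public

InStar : ∀ {n m} → Star n m → Vertex n → Set
InStar s x = (x ≡ center s) ⊎ (∃[ i ] x ≡ lookup (leaves s) i)

InVF : ∀ {n m} → List (Star n m) → Vertex n → Set
InVF F x = Any (λ s → InStar s x) F

data Reach {n m : ℕ} (F : List (Star n m)) : Vertex n → Vertex n → Set where
  here : ∀ {u} → ¬ InVF F u → Reach F u u
  step : ∀ {u v w} → ¬ InVF F u → FQAdj n u v → Reach F v w → Reach F u w

IsCut : ∀ {n m} → List (Star n m) → Set
IsCut {n} F =
  (∃[ u ] ∃[ v ] (¬ InVF F u × ¬ InVF F v × ¬ Reach F u v))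
  ⊎ (∃[ u ] (¬ InVF F u × (∀ (v : Vertex n) → ¬ InVF F v → v ≡ u)))

-- κ(FQ_n; K_{1,m}) ≤ b  :⇔  there is a K_{1,m}-structure cut of cardinality ≤ b
-- (a list of length ≤ b represents a set of at most b stars).
KappaStarLe : (n m b : ℕ) → Set
KappaStarLe n m b = Σ (List (Star n m)) λ F → IsCut F × length F ≤ b

-- The all-zero vertex u of FQ_n has the n + 1 neighbours u + e_1, …, u + e_n and ū. Split them
-- into ⌈(n+1)/2⌉ pairs {x, y}. The two vertices of a pair have a common neighbour c ≠ u, and a
-- K_{1,m} centred at c can take both x and y among its leaves. For n ≥ 3 the folded hypercube has
-- no triangles, so no such star contains u; the stars therefore cover all neighbours of u but not
-- u itself, and FQ_n − V(F) is either disconnected or the single vertex u.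

module Submission where

open import Defs
open import Data.Nat using (ℕ; zero; suc; _≤_; z≤n; s≤s; ⌈_/2⌉)
open import Data.Nat.Properties using (≤-reflexive)
open import Data.Bool using (Bool; true; false; not; _xor_)
open import Data.Bool.Properties using (xor-assoc; xor-comm; xor-same; xor-identityʳ; not-¬)
  renaming (_≟_ to _≟ᵇ_)
open import Data.Fin using (Fin; inject≤) renaming (zero to fz; suc to fs)
open import Data.Fin.Properties using (_≟_; suc-injective; inject≤-injective)
  renaming (any? to anyFin?)
import Data.Fin.Permutation.Components as PC
open import Data.Fin.Permutation using (Permutation′; transpose; _∘ₚ_; _⟨$⟩ʳ_)
open import Function.Bundles using (Injection)
open import Function.Properties.Inverse using (↔⇒↣)
open import Data.Vec using ([]; _∷_; lookup; tabulate; replicate; _[_]%=_)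
open import Data.Vec.Properties using (lookup∘updateAt; lookup∘updateAt′; lookup-map; lookup∘tabulate)
  renaming (≡-dec to ≡-decᵛ)
open import Data.Vec.Relation.Binary.Pointwise.Extensional using (ext; Pointwise-≡⇒≡)
open import Data.List using (List; []; _∷_; length; map; foldr)
open import Data.List.Properties using (length-map)
open import Data.List.Relation.Unary.Any using (Any; here; there; any?; satisfied)
  renaming (map to mapᴬ)
open import Data.List.Relation.Unary.Any.Properties using (map⁺; map⁻)
open import Data.Product using (∃; ∃-syntax; _×_; _,_)
open import Data.Sum using (_⊎_; inj₁; inj₂)
open import Function using (_∘_)
open import Function.Definitions using (Injective)
open import Relation.Nullary using (¬_; Dec; does; yes; no; contradiction)
open import Relation.Nullary.Decidable using (dec-true; dec-false; map′; decidable-stable; ¬?; _×-dec_; _⊎-dec_)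
open import Relation.Unary using (Decidable)
open import Relation.Binary.PropositionalEquality
  using (_≡_; _≢_; refl; sym; trans; cong; subst; module ≡-Reasoning)
open ≡-Reasoning

flips : ∀ {n} → Fin (suc n) → Fin n → Bool
flips fz     p = true
flips (fs i) p = does (i ≟ p)

neighbour : ∀ {n} → Fin (suc n) → Vertex n → Vertex n
neighbour fz     x = compl x
neighbour (fs i) x = x [ i ]%= not

lookup-neighbour : ∀ {n} (k : Fin (suc n)) x p → lookup (neighbour k x) p ≡ lookup x p xor flips k p
lookup-neighbour fz x p = trans (lookup-map p not x) (xor-comm true _)
lookup-neighbour (fs i) x p with i ≟ p
... | yes refl = trans (lookup∘updateAt i x) (xor-comm true _)
... | no i≢p   = trans (lookup∘updateAt′ p i (i≢p ∘ sym) x) (sym (xor-identityʳ _))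

lookup-neighbour² : ∀ {n} (k l : Fin (suc n)) x p →
                    lookup (neighbour k (neighbour l x)) p ≡ (lookup x p xor flips l p) xor flips k p
lookup-neighbour² k l x p = trans (lookup-neighbour k _ p) (cong (_xor flips k p) (lookup-neighbour l x p))

≡-by-lookup : ∀ {n} {x y : Vertex n} → (∀ p → lookup x p ≡ lookup y p) → x ≡ y
≡-by-lookup eq = Pointwise-≡⇒≡ (ext eq)

neighbour-involutive : ∀ {n} (k : Fin (suc n)) x → neighbour k (neighbour k x) ≡ x
neighbour-involutive k x = ≡-by-lookup λ p → begin
  lookup (neighbour k (neighbour k x)) p   ≡⟨ lookup-neighbour² k k x p ⟩
  (lookup x p xor flips k p) xor flips k p ≡⟨ xor-assoc (lookup x p) _ _ ⟩
  lookup x p xor (flips k p xor flips k p) ≡⟨ cong (lookup x p xor_) (xor-same (flips k p)) ⟩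
  lookup x p xor false                     ≡⟨ xor-identityʳ _ ⟩
  lookup x p                               ∎

neighbour-comm : ∀ {n} (k l : Fin (suc n)) x → neighbour k (neighbour l x) ≡ neighbour l (neighbour k x)
neighbour-comm k l x = ≡-by-lookup λ p → begin
  lookup (neighbour k (neighbour l x)) p    ≡⟨ lookup-neighbour² k l x p ⟩
  (lookup x p xor flips l p) xor flips k p  ≡⟨ xor-assoc (lookup x p) _ _ ⟩
  lookup x p xor (flips l p xor flips k p)  ≡⟨ cong (lookup x p xor_) (xor-comm (flips l p) _) ⟩
  lookup x p xor (flips k p xor flips l p)  ≡⟨ xor-assoc (lookup x p) _ _ ⟨
  (lookup x p xor flips k p) xor flips l p  ≡⟨ lookup-neighbour² l k x p ⟨
  lookup (neighbour l (neighbour k x)) p    ∎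

neighbour-adjacent : ∀ {n} (k : Fin (suc n)) x → FQAdj n x (neighbour k x)
neighbour-adjacent fz     x = inj₂ refl
neighbour-adjacent (fs i) x = inj₁ (i , refl)

adjacent⇒neighbour : ∀ {n} {x y} → FQAdj n x y → ∃[ k ] y ≡ neighbour k x
adjacent⇒neighbour (inj₁ (i , y≡)) = fs i , y≡
adjacent⇒neighbour (inj₂ y≡)       = fz , y≡

walk : ∀ {n} → List (Fin (suc n)) → Vertex n → Vertex n
walk ks x = foldr neighbour x ks

-- Opaque so that the implicit arguments of parity-∷ are found by unification.
opaque
  parity : ∀ {n} → List (Fin (suc n)) → Fin n → Bool
  parity ks p = foldr (λ k b → flips k p xor b) false ks

opaque
  unfolding parity

  parity-[] : ∀ {n} {p : Fin n} → parity [] p ≡ false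
  parity-[] = refl

  parity-∷ : ∀ {n} {k : Fin (suc n)} {ks p s t} →
             flips k p ≡ s → parity ks p ≡ t → parity (k ∷ ks) p ≡ s xor t
  parity-∷ refl refl = refl

lookup-walk : ∀ {n} ks (x : Vertex n) p → lookup (walk ks x) p ≡ lookup x p xor parity ks p
lookup-walk []       x p = sym (trans (cong (lookup x p xor_) parity-[]) (xor-identityʳ _))
lookup-walk (k ∷ ks) x p = begin
  lookup (neighbour k (walk ks x)) p                  ≡⟨ lookup-neighbour k _ p ⟩
  lookup (walk ks x) p xor flips k p                  ≡⟨ cong (_xor flips k p) (lookup-walk ks x p) ⟩
  (lookup x p xor parity ks p) xor flips k p          ≡⟨ xor-assoc (lookup x p) _ _ ⟩
  lookup x p xor (parity ks p xor flips k p)          ≡⟨ cong (lookup x p xor_) (xor-comm (parity ks p) _) ⟩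
  lookup x p xor (flips k p xor parity ks p)          ≡⟨ cong (lookup x p xor_) (parity-∷ refl refl) ⟨
  lookup x p xor parity (k ∷ ks) p                    ∎

walk-≢ : ∀ {n} ks (x : Vertex n) p → parity ks p ≡ true → walk ks x ≢ x
walk-≢ ks x p odd walk≡x = not-¬ refl (sym (begin
  not (lookup x p)                ≡⟨ xor-comm true _ ⟩
  lookup x p xor true             ≡⟨ cong (lookup x p xor_) odd ⟨
  lookup x p xor parity ks p      ≡⟨ lookup-walk ks x p ⟨
  lookup (walk ks x) p            ≡⟨ cong (λ y → lookup y p) walk≡x ⟩
  lookup x p                      ∎))

flips-self : ∀ {n} (i : Fin n) → flips (fs i) i ≡ true
flips-self i = dec-true (i ≟ i) refl

flips-other : ∀ {n} {i p : Fin n} → i ≢ p → flips (fs i) p ≡ false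
flips-other {i = i} {p} = dec-false (i ≟ p)

avoid₁ : ∀ {n} (i : Fin (suc (suc n))) → ∃[ p ] i ≢ p
avoid₁ fz     = fs fz , λ ()
avoid₁ (fs i) = fz , λ ()

avoid₂ : ∀ {n} (i j : Fin (suc (suc (suc n)))) → ∃[ p ] i ≢ p × j ≢ p
avoid₂ fz          fz          = fs fz , (λ ()) , (λ ())
avoid₂ fz          (fs fz)     = fs (fs fz) , (λ ()) , (λ ())
avoid₂ fz          (fs (fs j)) = fs fz , (λ ()) , (λ ())
avoid₂ (fs fz)     fz          = fs (fs fz) , (λ ()) , (λ ())
avoid₂ (fs (fs i)) fz          = fs fz , (λ ()) , (λ ())
avoid₂ (fs i)      (fs j)      = fz , (λ ()) , (λ ())

odd-parity₁ : ∀ {n} (a : Fin (suc (suc n))) → ∃[ p ] parity (a ∷ []) p ≡ true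
odd-parity₁ fz     = fz , parity-∷ refl parity-[]
odd-parity₁ (fs i) = i , parity-∷ (flips-self i) parity-[]

odd-parity₂ : ∀ {n} {a b : Fin (suc (suc (suc n)))} → a ≢ b → ∃[ p ] parity (b ∷ a ∷ []) p ≡ true
odd-parity₂ {a = fz}   {fz}   a≢b = contradiction refl a≢b
odd-parity₂ {a = fz}   {fs j} a≢b with avoid₁ j
... | p , j≢p = p , parity-∷ (flips-other j≢p) (parity-∷ refl parity-[])
odd-parity₂ {a = fs i} {fz}   a≢b with avoid₁ i
... | p , i≢p = p , parity-∷ refl (parity-∷ (flips-other i≢p) parity-[])
odd-parity₂ {a = fs i} {fs j} a≢b =
  i , parity-∷ (flips-other (a≢b ∘ cong fs ∘ sym)) (parity-∷ (flips-self i) parity-[])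

odd-parity₃ : ∀ {n} {a b k : Fin (suc (suc (suc (suc n))))} → a ≢ b → b ≢ k → a ≢ k →
              ∃[ p ] parity (k ∷ b ∷ a ∷ []) p ≡ true
odd-parity₃ {a = fz}   {fz}   {_}    a≢b _   _   = contradiction refl a≢b
odd-parity₃ {a = fz}   {fs _} {fz}   _   _   a≢k = contradiction refl a≢k
odd-parity₃ {a = fz}   {fs j} {fs l} _   _   _   with avoid₂ j l
... | p , j≢p , l≢p =
  p , parity-∷ (flips-other l≢p) (parity-∷ (flips-other j≢p) (parity-∷ refl parity-[]))
odd-parity₃ {a = fs _} {fz}   {fz}   _   b≢k _   = contradiction refl b≢k
odd-parity₃ {a = fs i} {fz}   {fs l} _   _   _   with avoid₂ i l
... | p , i≢p , l≢p =
  p , parity-∷ (flips-other l≢p) (parity-∷ refl (parity-∷ (flips-other i≢p) parity-[]))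
odd-parity₃ {a = fs i} {fs j} {fz}   _   _   _   with avoid₂ i j
... | p , i≢p , j≢p =
  p , parity-∷ refl (parity-∷ (flips-other j≢p) (parity-∷ (flips-other i≢p) parity-[]))
odd-parity₃ {a = fs i} {fs j} {fs l} a≢b _   a≢k =
  i , parity-∷ (flips-other (a≢k ∘ cong fs ∘ sym))
        (parity-∷ (flips-other (a≢b ∘ cong fs ∘ sym)) (parity-∷ (flips-self i) parity-[]))

neighbour-≢ : ∀ {n} (k : Fin (suc (suc n))) (x : Vertex (suc n)) → neighbour k x ≢ x
neighbour-≢ k x with odd-parity₁ k
... | p , odd = walk-≢ (k ∷ []) x p odd

neighbour²-≢ : ∀ {n} {a b : Fin (suc (suc (suc n)))} (x : Vertex (suc (suc n))) →
               a ≢ b → neighbour b (neighbour a x) ≢ x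
neighbour²-≢ {a = a} {b} x a≢b with odd-parity₂ a≢b
... | p , odd = walk-≢ (b ∷ a ∷ []) x p odd

neighbour-injective : ∀ {n} {a b : Fin (suc (suc (suc n)))} (x : Vertex (suc (suc n))) →
                      neighbour a x ≡ neighbour b x → a ≡ b
neighbour-injective {a = a} {b} x eq with a ≟ b
... | yes a≡b = a≡b
... | no  a≢b = contradiction (trans (cong (neighbour b) eq) (neighbour-involutive b x)) (neighbour²-≢ x a≢b)

no-triangle : ∀ {n} {a b : Fin (suc (suc (suc (suc n))))} k (x : Vertex (suc (suc (suc n)))) →
              a ≢ b → neighbour k (neighbour b (neighbour a x)) ≢ x
no-triangle {a = a} {b} k x a≢b with k ≟ a | k ≟ b
... | yes refl | _        = subst (_≢ x) (sym kbk≡b) (neighbour-≢ b x)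
  where
  kbk≡b : neighbour k (neighbour b (neighbour k x)) ≡ neighbour b x
  kbk≡b = trans (neighbour-comm k b _) (cong (neighbour b) (neighbour-involutive k x))
... | no _     | yes refl = subst (_≢ x) (sym (neighbour-involutive k _)) (neighbour-≢ a x)
... | no k≢a | no k≢b with odd-parity₃ a≢b (k≢b ∘ sym) (k≢a ∘ sym)
...   | p , odd = walk-≢ (k ∷ b ∷ a ∷ []) x p odd

_≟ᵛ_ : ∀ {n} → (x y : Vertex n) → Dec (x ≡ y)
_≟ᵛ_ = ≡-decᵛ _≟ᵇ_

InStar? : ∀ {n m} (s : Star n m) → Decidable (InStar s)
InStar? s x = (x ≟ᵛ center s) ⊎-dec anyFin? (λ i → x ≟ᵛ lookup (leaves s) i)

InVF? : ∀ {n m} (F : List (Star n m)) → Decidable (InVF F)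
InVF? F x = any? (λ s → InStar? s x) F

any-vertex? : ∀ {n} {P : Vertex n → Set} → Decidable P → Dec (∃ P)
any-vertex? {zero}  P? = map′ ([] ,_) (λ { ([] , p) → p }) (P? [])
any-vertex? {suc n} P? = map′
  (λ { (inj₁ (v , p)) → true ∷ v , p ; (inj₂ (v , p)) → false ∷ v , p })
  (λ { (true ∷ v , p) → inj₁ (v , p) ; (false ∷ v , p) → inj₂ (v , p) })
  (any-vertex? (P? ∘ (true ∷_)) ⊎-dec any-vertex? (P? ∘ (false ∷_)))

Reach-∉ : ∀ {n m} {F : List (Star n m)} {u v} → Reach F u v → ¬ InVF F u
Reach-∉ (here u∉)     = u∉
Reach-∉ (step u∉ _ _) = u∉

isolated⇒cut : ∀ {n m} (F : List (Star n m)) (u : Vertex n) → ¬ InVF F u →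
               (∀ v → FQAdj n u v → InVF F v) → IsCut F
isolated⇒cut F u u∉ N[u]⊆VF with any-vertex? (λ v → ¬? (v ≟ᵛ u) ×-dec ¬? (InVF? F v))
... | yes (v , v≢u , v∉) = inj₁ (u , v , u∉ , v∉ , v≢u ∘ reach-only-u)
  where
  reach-only-u : ∀ {v} → Reach F u v → v ≡ u
  reach-only-u (here _)           = refl
  reach-only-u (step _ u~w w⇝v)  = contradiction (N[u]⊆VF _ u~w) (Reach-∉ w⇝v)
... | no ∄ = inj₂ (u , u∉ , λ v v∉ → decidable-stable (v ≟ᵛ u) (λ v≢u → ∄ (v , v≢u , v∉)))

record DistinctPair (K : ℕ) : Set where
  constructor ⟨_,_∣_⟩
  field
    first second  : Fin K
    first≢second  : first ≢ second
open DistinctPair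

_∈ᵖ_ : ∀ {K} → Fin K → DistinctPair K → Set
k ∈ᵖ p = k ≡ first p ⊎ k ≡ second p

shift₂ : ∀ {K} → DistinctPair K → DistinctPair (suc (suc K))
shift₂ ⟨ a , b ∣ a≢b ⟩ = ⟨ fs (fs a) , fs (fs b) ∣ a≢b ∘ suc-injective ∘ suc-injective ⟩

pairing : ∀ K → List (DistinctPair (suc (suc K)))
pairing zero          = ⟨ fz , fs fz ∣ (λ ()) ⟩ ∷ []
pairing (suc zero)    = ⟨ fz , fs fz ∣ (λ ()) ⟩ ∷ ⟨ fs (fs fz) , fz ∣ (λ ()) ⟩ ∷ []
pairing (suc (suc K)) = ⟨ fz , fs fz ∣ (λ ()) ⟩ ∷ map shift₂ (pairing K)

length-pairing : ∀ K → length (pairing K) ≡ ⌈ suc (suc K) /2⌉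
length-pairing zero          = refl
length-pairing (suc zero)    = refl
length-pairing (suc (suc K)) = cong suc (trans (length-map shift₂ (pairing K)) (length-pairing K))

pairing-covers : ∀ K (k : Fin (suc (suc K))) → Any (k ∈ᵖ_) (pairing K)
pairing-covers zero          fz                = here (inj₁ refl)
pairing-covers zero          (fs fz)           = here (inj₂ refl)
pairing-covers (suc zero)    fz                = here (inj₁ refl)
pairing-covers (suc zero)    (fs fz)           = here (inj₂ refl)
pairing-covers (suc zero)    (fs (fs fz))      = there (here (inj₁ refl))
pairing-covers (suc (suc K)) fz                = here (inj₁ refl)
pairing-covers (suc (suc K)) (fs fz)           = here (inj₂ refl)
pairing-covers (suc (suc K)) (fs (fs k))       = there (map⁺ (mapᴬ (λ {p} → shift-∈ p) (pairing-covers K k)))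
  where
  shift-∈ : ∀ p → k ∈ᵖ p → fs (fs k) ∈ᵖ shift₂ p
  shift-∈ _ (inj₁ refl) = inj₁ refl
  shift-∈ _ (inj₂ refl) = inj₂ refl

transpose-hits : ∀ {K} (i j : Fin K) → PC.transpose i j i ≡ j
transpose-hits i j rewrite dec-true (i ≟ i) refl = refl

transpose-fixes : ∀ {K} (i j : Fin K) {k} → k ≢ i → k ≢ j → PC.transpose i j k ≡ k
transpose-fixes i j {k} k≢i k≢j rewrite dec-false (k ≟ i) k≢i | dec-false (k ≟ j) k≢j = refl

-- ∘ₚ applies its left argument first: this is (0 a) after (1 b′), b′ being the preimage of b under (0 a).
frontTo : ∀ {K} → Fin (suc (suc K)) → Fin (suc (suc K)) → Permutation′ (suc (suc K))
frontTo a b = transpose (fs fz) (PC.transpose a fz b) ∘ₚ transpose fz a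

frontTo-1 : ∀ {K} (a b : Fin (suc (suc K))) → frontTo a b ⟨$⟩ʳ fs fz ≡ b
frontTo-1 a b =
  trans (cong (PC.transpose fz a) (transpose-hits (fs fz) (PC.transpose a fz b))) (PC.transpose-inverse fz a)

frontTo-0 : ∀ {K} {a b : Fin (suc (suc K))} → a ≢ b → frontTo a b ⟨$⟩ʳ fz ≡ a
frontTo-0 {a = a} {b} a≢b =
  trans (cong (PC.transpose fz a) (transpose-fixes (fs fz) (PC.transpose a fz b) (λ ()) 0≢b′)) (transpose-hits fz a)
  where
  0≢b′ : fz ≢ PC.transpose a fz b
  0≢b′ 0≡b′ = a≢b (trans (sym (transpose-hits fz a)) (trans (cong (PC.transpose fz a) 0≡b′) (frontTo-1 a b)))

module _ {n m} (m≤ : suc (suc m) ≤ suc (suc (suc n))) (u : Vertex (suc (suc n)))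
         (p : DistinctPair (suc (suc (suc n)))) where

  private
    a = first p
    b = second p
    c = neighbour b (neighbour a u)
    gen : Fin (suc (suc m)) → Fin (suc (suc (suc n)))
    gen i = frontTo a b ⟨$⟩ʳ inject≤ i m≤
    gen-injective : Injective _≡_ _≡_ gen
    gen-injective = inject≤-injective m≤ m≤ _ _ ∘ Injection.injective (↔⇒↣ (frontTo a b))
    leaf : Fin (suc (suc m)) → Vertex (suc (suc n))
    leaf i = neighbour (gen i) c
    leaf-at : ∀ {k} i → gen i ≡ k → lookup (tabulate leaf) i ≡ neighbour k c
    leaf-at i refl = lookup∘tabulate leaf i

  pairStar : Star (suc (suc n)) (suc (suc m))
  pairStar = record
    { center   = c
    ; leaves   = tabulate leaf
    ; distinct = λ i j eq → gen-injective (neighbour-injective c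
                   (trans (sym (lookup∘tabulate leaf i)) (trans eq (lookup∘tabulate leaf j))))
    ; adj      = λ i → subst (FQAdj _ c) (sym (lookup∘tabulate leaf i)) (neighbour-adjacent (gen i) c)
    }

  pairStar-∋ : ∀ {k} → k ∈ᵖ p → InStar pairStar (neighbour k u)
  pairStar-∋ (inj₁ refl) = inj₂ (fs fz , sym (begin
    lookup (tabulate leaf) (fs fz)  ≡⟨ leaf-at (fs fz) (frontTo-1 a b) ⟩
    neighbour b c                   ≡⟨ neighbour-involutive b _ ⟩
    neighbour a u                   ∎))
  pairStar-∋ (inj₂ refl) = inj₂ (fz , sym (begin
    lookup (tabulate leaf) fz       ≡⟨ leaf-at fz (frontTo-0 (first≢second p)) ⟩
    neighbour a c                   ≡⟨ neighbour-comm a b _ ⟩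
    neighbour b (neighbour a (neighbour a u)) ≡⟨ cong (neighbour b) (neighbour-involutive a u) ⟩
    neighbour b u                   ∎))

star-∌-at-distance-2 : ∀ {n m} (s : Star (suc (suc (suc n))) m) {u a b} → a ≢ b →
                       center s ≡ neighbour b (neighbour a u) → ¬ InStar s u
star-∌-at-distance-2 s a≢b c≡ (inj₁ u≡c) = neighbour²-≢ _ a≢b (sym (trans u≡c c≡))
star-∌-at-distance-2 s {u} a≢b c≡ (inj₂ (i , u≡leaf)) with adjacent⇒neighbour (adj s i)
... | k , leaf≡ = no-triangle k u a≢b (sym (trans u≡leaf (trans leaf≡ (cong (neighbour k) c≡))))

lemma3p6 : ∀ (n m : ℕ) → 3 ≤ n → 2 ≤ m → m ≤ suc n
         → KappaStarLe n m ⌈ suc n /2⌉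
lemma3p6 (suc (suc (suc n))) (suc (suc m)) (s≤s (s≤s (s≤s z≤n))) (s≤s (s≤s z≤n)) m≤ =
  F , isolated⇒cut F u u∉VF N[u]⊆VF , ≤-reflexive (trans (length-map _ pairs) (length-pairing _))
  where
  u     = replicate _ false
  pairs = pairing (suc (suc n))
  F     = map (pairStar m≤ u) pairs

  u∉VF : ¬ InVF F u
  u∉VF u∈VF with satisfied (map⁻ {xs = pairs} u∈VF)
  ... | p , u∈s = star-∌-at-distance-2 (pairStar m≤ u p) (first≢second p) refl u∈s

  N[u]⊆VF : ∀ v → FQAdj _ u v → InVF F v
  N[u]⊆VF v u~v with adjacent⇒neighbour u~v
  ... | k , refl = map⁺ (mapᴬ (λ {p} → pairStar-∋ m≤ u p) (pairing-covers _ k))
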